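{- On all (vertex-colored) graphs: (1) for every formula of separator logic there is an equivalent formula of flip-connectivity logic; (2) for every formula of flip-connectivity logic there is an equivalent formula of flip-reachability logic; (3) for every formula of flip-reachability logic there is an equivalent formula of low rank MSO.
   Context: Graphs are finite, simple, undirected, vertex-colored. All logics below allow free vertex and set variables. Separator logic: first-order logic over graphs with predicates $\mathrm{conn}_k(s,t,a_1,\dots,a_k)$ holding iff some path with endpoints $s,t$ avoids $a_1,\dots,a_k$. Atomic type $\mathrm{atp}(v_1,\dots,v_k)$: set of atomic formulas $x_i=x_j$, $E(x_i,x_j)$, $U(x_i)$ satisfied by the tuple; $\mathrm{atp}^k$: set of all atomic types of $k$-tuples. For $A\subseteq\mathrm{atp}^{k+1}\times\mathrm{atp}^{k+1}$ and $\bar a\in V(G)^k$, $G\oplus_{\bar a}A$ is the digraph on $V(G)$ with arc $\vec{uv}$ ($u\ne v$) iff $[uv\in E(G)]$ xor $[(\mathrm{atp}(u,\bar a),\mathrm{atp}(v,\bar a))\in A]$; for symmetric $A$ it is viewed as undirected. Flip-connectivity logic: first-order logic with predicates $\mathrm{flipconn}_{k,A}(s,t,\bar a)$ ($A$ symmetric) holding iff $s,t$ are in the same connected component of $G\oplus_{\bar a}A$. Flip-reachability logic: first-order logic with predicates $\mathrm{flipreach}_{k,A}(s,t,\bar a)$ (any $A$) holding iff there is a directed $s$-to-$t$ path in $G\oplus_{\bar a}A$. Low rank MSO: MSO over graphs in which set quantifiers are $\exists X\colon r$/$\forall X\colon r$ ranging over vertex sets $X$ whose cutrank (rank over $\mathbb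 F_2$ of the adjacency matrix between $X$ and $V(G)\setminus X$) is at most $r$. -}

module Defs where

open import Data.Nat using (ℕ; zero; suc)
open import Data.Fin using (Fin; _≟_)
import Data.Fin as Fin
open import Data.Bool using (Bool; true; false; T; _xor_; _∧_)
open import Data.Vec using (Vec; tabulate)
open import Data.Vec.Functional using (_∷_)
open import Data.List using (List; []) renaming (_∷_ to _∷ₗ_)
open import Data.List.Relation.Unary.All using (All)
open import Data.List.Relation.Unary.Unique.Propositional using (Unique)
open import Data.Product using (Σ; _×_; proj₁)
open import Data.Empty using (⊥)
open import Relation.Nullary using (¬_)
open import Relation.Nullary.Decidable using (isYes)
open import Relation.Binary.PropositionalEquality using (_≡_; _≢_)
open import Function.Bundles using (_⇔_)

record Graph (c : ℕ) : Set where
  field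
    n      : ℕ
    adj    : Fin n → Fin n → Bool
    sym    : ∀ u v → adj u v ≡ adj v u
    irrefl : ∀ u → adj u u ≡ false
    col    : Fin c → Fin n → Bool

open Graph public

V : ∀ {c} → Graph c → Set
V G = Fin (n G)

data Walk {n : ℕ} (R : Fin n → Fin n → Set) : Fin n → Fin n → Set where
  stop : ∀ v → Walk R v v
  step : ∀ {u v w} → R u v → Walk R v w → Walk R u w

verts : ∀ {n} {R : Fin n → Fin n → Set} {s t} → Walk R s t → List (Fin n)
verts (stop v) = v ∷ₗ []
verts (step {u} _ w) = u ∷ₗ verts w

Path : ∀ {n} → (Fin n → Fin n → Set) → Fin n → Fin n → Set
Path R s t = Σ (Walk R s t) (λ w → Unique (verts w))

Edge : ∀ {c} (G : Graph c) → V G → V G → Set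
Edge G u v = T (adj G u v)

-- Atomic types of k-tuples: truth values of x_i = x_j, E(x_i,x_j), U(x_i).

record Atp (c k : ℕ) : Set where
  constructor mkAtp
  field
    eqs  : Vec (Vec Bool k) k
    edgs : Vec (Vec Bool k) k
    cols : Vec (Vec Bool k) c

atp : ∀ {c k} (G : Graph c) → (Fin k → V G) → Atp c k
atp G w = mkAtp (tabulate λ i → tabulate λ j → isYes (w i ≟ w j))
                (tabulate λ i → tabulate λ j → adj G (w i) (w j))
                (tabulate λ u → tabulate λ i → col G u (w i))

-- A ⊆ atp^{k+1} × atp^{k+1} given by its characteristic function.
-- Arc u→v of G ⊕_ā A.
FlipArc : ∀ {c k} (G : Graph c) → (Atp c (suc k) → Atp c (suc k) → Bool)
          → (Fin k → V G) → V G → V G → Set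
FlipArc G A a u v =
  (u ≢ v) × T (adj G u v xor A (atp G (u ∷ a)) (atp G (v ∷ a)))

-- Cutrank over F₂.  rank ≤ r of the X × (V∖X) adjacency matrix:
-- its row space is spanned by r vectors over F₂.

xorSum : (r : ℕ) → (Fin r → Bool) → Bool
xorSum zero f = false
xorSum (suc r) f = f Fin.zero xor xorSum r (λ i → f (Fin.suc i))

CutRankAtMost : ∀ {c} (G : Graph c) → (V G → Bool) → ℕ → Set
CutRankAtMost G X r =
  Σ (Fin r → V G → Bool) λ B →
    ∀ x → X x ≡ true →
      Σ (Fin r → Bool) λ coef →
        ∀ y → X y ≡ false → adj G x y ≡ xorSum r (λ i → coef i ∧ B i y)

-- Generic first-order syntax with k free vertex variables and m free set
-- variables (de Bruijn), extra atoms `Atom` and set-quantifier labels `SetQ`.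

data Formula (c : ℕ) (Atom : ℕ → Set) (SetQ : Set) : ℕ → ℕ → Set where
  eqᶠ   : ∀ {k m} → Fin k → Fin k → Formula c Atom SetQ k m
  edgeᶠ : ∀ {k m} → Fin k → Fin k → Formula c Atom SetQ k m
  colᶠ  : ∀ {k m} → Fin c → Fin k → Formula c Atom SetQ k m
  memᶠ  : ∀ {k m} → Fin k → Fin m → Formula c Atom SetQ k m
  atomᶠ : ∀ {k m} → Atom k → Formula c Atom SetQ k m
  notᶠ  : ∀ {k m} → Formula c Atom SetQ k m → Formula c Atom SetQ k m
  andᶠ  : ∀ {k m} → Formula c Atom SetQ k m → Formula c Atom SetQ k m
          → Formula c Atom SetQ k m
  exVᶠ  : ∀ {k m} → Formula c Atom SetQ (suc k) m → Formula c Atom SetQ k m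
  exSᶠ  : ∀ {k m} → SetQ → Formula c Atom SetQ k (suc m) → Formula c Atom SetQ k m

sem : ∀ {c} {Atom : ℕ → Set} {SetQ : Set}
      → (semAtom : ∀ {k} → Atom k → (G : Graph c) → (Fin k → V G) → Set)
      → (semQ : SetQ → (G : Graph c) → (V G → Bool) → Set)
      → ∀ {k m} → Formula c Atom SetQ k m
      → (G : Graph c) → (Fin k → V G) → (Fin m → V G → Bool) → Set
sem sA sQ (eqᶠ x y)   G ρ σ = ρ x ≡ ρ y
sem sA sQ (edgeᶠ x y) G ρ σ = Edge G (ρ x) (ρ y)
sem sA sQ (colᶠ u x)  G ρ σ = T (col G u (ρ x))
sem sA sQ (memᶠ x X)  G ρ σ = σ X (ρ x) ≡ true
sem sA sQ (atomᶠ a)   G ρ σ = sA a G ρ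
sem sA sQ (notᶠ φ)    G ρ σ = ¬ sem sA sQ φ G ρ σ
sem sA sQ (andᶠ φ ψ)  G ρ σ = sem sA sQ φ G ρ σ × sem sA sQ ψ G ρ σ
sem sA sQ (exVᶠ φ)    G ρ σ = Σ (V G) λ v → sem sA sQ φ G (v ∷ ρ) σ
sem sA sQ (exSᶠ q φ)  G ρ σ =
  Σ (V G → Bool) λ X → sQ q G X × sem sA sQ φ G ρ (X ∷ σ)

noSetQ : ∀ {c} → ⊥ → (G : Graph c) → (V G → Bool) → Set
noSetQ () G X

record SepAtom (k : ℕ) : Set where
  constructor conn
  field
    j : ℕ
    s t : Fin k
    as : Fin j → Fin k

semSep : ∀ {c k} → SepAtom k → (G : Graph c) → (Fin k → V G) → Set
semSep (conn j s t as) G ρ =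
  Σ (Path (Edge G) (ρ s) (ρ t)) λ p →
    All (λ v → ∀ i → v ≢ ρ (as i)) (verts (proj₁ p))

SepFormula : ℕ → ℕ → ℕ → Set
SepFormula c = Formula c SepAtom ⊥

⟦_⟧Sep : ∀ {c k m} → SepFormula c k m
         → (G : Graph c) → (Fin k → V G) → (Fin m → V G → Bool) → Set
⟦ φ ⟧Sep = sem semSep noSetQ φ

record FlipConnAtom (c k : ℕ) : Set where
  constructor flipconn
  field
    j    : ℕ
    A    : Atp c (suc j) → Atp c (suc j) → Bool
    symA : ∀ p q → A p q ≡ A q p
    s t  : Fin k
    as   : Fin j → Fin k

semFlipConn : ∀ {c k} → FlipConnAtom c k → (G : Graph c) → (Fin k → V G) → Set
semFlipConn (flipconn j A _ s t as) G ρ =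
  Path (FlipArc G A (λ i → ρ (as i))) (ρ s) (ρ t)

FlipConnFormula : ℕ → ℕ → ℕ → Set
FlipConnFormula c = Formula c (FlipConnAtom c) ⊥

⟦_⟧FC : ∀ {c k m} → FlipConnFormula c k m
        → (G : Graph c) → (Fin k → V G) → (Fin m → V G → Bool) → Set
⟦ φ ⟧FC = sem semFlipConn noSetQ φ

record FlipReachAtom (c k : ℕ) : Set where
  constructor flipreach
  field
    j    : ℕ
    A    : Atp c (suc j) → Atp c (suc j) → Bool
    s t  : Fin k
    as   : Fin j → Fin k

semFlipReach : ∀ {c k} → FlipReachAtom c k → (G : Graph c) → (Fin k → V G) → Set
semFlipReach (flipreach j A s t as) G ρ =
  Path (FlipArc G A (λ i → ρ (as i))) (ρ s) (ρ t)

FlipReachFormula : ℕ → ℕ → ℕ → Set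
FlipReachFormula c = Formula c (FlipReachAtom c) ⊥

⟦_⟧FR : ∀ {c k m} → FlipReachFormula c k m
        → (G : Graph c) → (Fin k → V G) → (Fin m → V G → Bool) → Set
⟦ φ ⟧FR = sem semFlipReach noSetQ φ

NoAtom : ℕ → Set
NoAtom _ = ⊥

noAtom : ∀ {c k} → NoAtom k → (G : Graph c) → (Fin k → V G) → Set
noAtom () G ρ

LowRankMSO : ℕ → ℕ → ℕ → Set
LowRankMSO c = Formula c NoAtom ℕ

⟦_⟧LR : ∀ {c k m} → LowRankMSO c k m
        → (G : Graph c) → (Fin k → V G) → (Fin m → V G → Bool) → Set
⟦ φ ⟧LR = sem noAtom (λ r G X → CutRankAtMost G X r) φ

Equiv : ∀ {c k m}
        (S₁ S₂ : (G : Graph c) → (Fin k → V G) → (Fin m → V G → Bool) → Set) → Set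
Equiv {c} {k} {m} S₁ S₂ =
  (G : Graph c) (ρ : Fin k → V G) (σ : Fin m → V G → Bool) → S₁ G ρ σ ⇔ S₂ G ρ σ

-- (1) Deleting every edge at the tuple ā is a flip: uv is flipped exactly when one endpoint is some aᵢ
-- adjacent to the other, which the atomic types of (u, ā) and (v, ā) record. In the flipped graph a path
-- starting outside ā never enters ā, so conn(s, t, ā) is flipconn(s, t, ā) ∧ s ∉ ā.
-- (2) flipconn is the symmetric special case of flipreach.
-- (3) t is unreachable from s in G ⊕ā A iff some vertex set containing s but not t is closed under arcs.
-- The reachability set of s is such a set, and across any closed cut adjacency equals A applied to the
-- atomic types of the endpoints, so closed sets have cutrank at most the number of atomic types. The arc
-- relation itself is quantifier-free definable from ā.
module Submission where

open import Defs hiding (sym)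
open import Data.Nat using (ℕ; zero; suc; _*_; _^_; _≤_; z≤n; s≤s)
open import Data.Fin using (Fin; _≟_)
import Data.Fin as Fin
open import Data.Fin.Properties using (2↔Bool; *↔×; any?; injective⇒≤)
open import Data.Bool using (Bool; true; false; T; _xor_; _∧_; _∨_)
import Data.Bool as Bool
open import Data.Bool.Properties using (T-≡; T-∧; T?; ∨-comm; xor-identityʳ; not-¬)
open import Data.Vec using (Vec; []; _∷_; lookup; tabulate)
open import Data.Vec.Properties using (lookup∘tabulate; tabulate∘lookup; tabulate-cong)
open import Data.Vec.Functional using () renaming (_∷_ to _∷ᶠ_)
open import Data.List using (List; length) renaming (lookup to lookupₗ; _∷_ to _∷ₗ_)
open import Data.List.Membership.Propositional using (_∈_)
open import Data.List.Membership.Propositional.Properties using (∈-lookup)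
open import Data.List.Relation.Unary.All as All using (All) renaming (_∷_ to _∷ᵃ_)
open import Data.List.Relation.Unary.All.Properties using (¬Any⇒All¬)
open import Data.List.Relation.Unary.Any as Any using (here; there)
open import Data.List.Relation.Unary.AllPairs using () renaming (_∷_ to _∷ᵖ_; [] to []ᵖ)
open import Data.List.Relation.Unary.Unique.Propositional using (Unique)
open import Data.Product using (Σ; ∃; _×_; _,_; proj₁; uncurry)
open import Data.Product.Function.NonDependent.Propositional using (_×-⇔_; _×-↩_)
open import Data.Product.Function.Dependent.Propositional using (congˡ)
open import Data.Empty using (⊥; ⊥-elim)
open import Relation.Nullary using (¬_; Dec; does; yes; no)
open import Relation.Nullary.Decidable using (isYes; map′; toWitness; fromWitness; decidable-stable; ¬?; _×-dec_)
open import Relation.Binary.PropositionalEquality using (_≡_; _≢_; refl; sym; trans; cong; cong₂; subst; module ≡-Reasoning)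
open import Function.Base using (_∘_; id)
open import Function.Bundles using (_⇔_; mk⇔; Equivalence; _↩_; mk↩; LeftInverse)
open import Function.Construct.Composition using (_↩-∘_)
open import Function.Properties.Inverse using (↔⇒↩)
open import Function.Properties.Equivalence using () renaming (refl to ⇔-refl; sym to ⇔-sym; trans to ⇔-trans)
open import Function.Related.Propositional using (Kind)
open import Function.Related.TypeIsomorphisms using (¬-cong-⇔)

open Equivalence using (to; from)

∀-cong-⇔ : ∀ {I : Set} {P Q : I → Set} → (∀ i → P i ⇔ Q i) → (∀ i → P i) ⇔ (∀ i → Q i)
∀-cong-⇔ P⇔Q = mk⇔ (λ p i → to (P⇔Q i) (p i)) (λ q i → from (P⇔Q i) (q i))

∃-cong-⇔ : ∀ {I : Set} {P Q : I → Set} → (∀ i → P i ⇔ Q i) → ∃ P ⇔ ∃ Q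
∃-cong-⇔ P⇔Q = congˡ {k = Kind.equivalence} (λ {i} → P⇔Q i)

True⇔ : ∀ {P : Set} {P? : Dec P} → T (isYes P?) ⇔ P
True⇔ = mk⇔ toWitness fromWitness

¬T⇔≡false : ∀ {b} → (¬ T b) ⇔ (b ≡ false)
¬T⇔≡false {false} = mk⇔ (λ _ → refl) (λ _ ())
¬T⇔≡false {true}  = mk⇔ (λ ¬t → ⊥-elim (¬t _)) (λ ())

T-xor⇔≢ : ∀ {x y} → T (x xor y) ⇔ (x ≢ y)
T-xor⇔≢ {false} {false} = mk⇔ (λ ()) (λ x≢y → x≢y refl)
T-xor⇔≢ {false} {true}  = mk⇔ (λ _ ()) _
T-xor⇔≢ {true}  {false} = mk⇔ (λ _ ()) _
T-xor⇔≢ {true}  {true}  = mk⇔ (λ ()) (λ x≢y → x≢y refl)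

entry : ∀ {A : Set} {a b} → Vec (Vec A b) a → Fin a → Fin b → A
entry M i j = lookup (lookup M i) j

tabulate² : ∀ {A : Set} {a b} → (Fin a → Fin b → A) → Vec (Vec A b) a
tabulate² f = tabulate λ i → tabulate (f i)

entry-tabulate² : ∀ {A : Set} {a b} (f : Fin a → Fin b → A) i j → entry (tabulate² f) i j ≡ f i j
entry-tabulate² f i j = trans (cong (λ row → lookup row j) (lookup∘tabulate _ i)) (lookup∘tabulate (f i) j)

tabulate²-≡⇔ : ∀ {A : Set} {a b} (f : Fin a → Fin b → A) M →
               (∀ i j → f i j ≡ entry M i j) ⇔ (tabulate² f ≡ M)
tabulate²-≡⇔ f M = mk⇔
  (λ f≗M → trans (tabulate-cong λ i → trans (tabulate-cong (f≗M i)) (tabulate∘lookup _)) (tabulate∘lookup M))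
  (λ f≡M i j → trans (sym (entry-tabulate² f i j)) (cong (λ N → entry N i j) f≡M))

×-↩-Fin : ∀ {A B : Set} {r s} → Fin r ↩ A → Fin s ↩ B → Fin (r * s) ↩ (A × B)
×-↩-Fin {r = r} {s} A↩ B↩ = (A↩ ×-↩ B↩) ↩-∘ ↔⇒↩ (*↔× {r} {s})

Vec-↩-Fin : ∀ {A : Set} {r} → Fin r ↩ A → ∀ n → Fin (r ^ n) ↩ Vec A n
Vec-↩-Fin A↩ zero    = mk↩ {to = λ _ → []} {from = λ _ → Fin.zero} λ { {[]} _ → refl }
Vec-↩-Fin {A} A↩ (suc n) = ∷-↩ ↩-∘ ×-↩-Fin A↩ (Vec-↩-Fin A↩ n)
  where
  ∷-↩ : (A × Vec A n) ↩ Vec A (suc n)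
  ∷-↩ = mk↩ {to = uncurry _∷_} {from = λ { (x ∷ xs) → x , xs }} λ { {_ ∷ _} refl → refl }

atpCodes : ℕ → ℕ → ℕ
atpCodes c k = (2 ^ k) ^ k * ((2 ^ k) ^ k * (2 ^ k) ^ c)

Atp-↩ : ∀ c k → Fin (atpCodes c k) ↩ Atp c k
Atp-↩ c k = mkAtp-↩ ↩-∘ ×-↩-Fin matrix-↩ (×-↩-Fin matrix-↩ matrix-↩)
  where
  matrix-↩ : ∀ {a} → Fin ((2 ^ k) ^ a) ↩ Vec (Vec Bool k) a
  matrix-↩ {a} = Vec-↩-Fin (Vec-↩-Fin (↔⇒↩ 2↔Bool) k) a
  mkAtp-↩ : (Vec (Vec Bool k) k × Vec (Vec Bool k) k × Vec (Vec Bool k) c) ↩ Atp c k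
  mkAtp-↩ = mk↩ {to = λ (E , D , C) → mkAtp E D C} {from = λ (mkAtp E D C) → E , D , C} λ { refl → refl }

codes-≢⇔≢ : ∀ {P : Set} {r} (P↩ : Fin r ↩ P) (f : P → P → Bool) {x y b} → let code = LeftInverse.to P↩ in
            (∀ i i′ → ¬ (x ≡ code i × y ≡ code i′ × b ≡ f (code i) (code i′))) ⇔ (b ≢ f x y)
codes-≢⇔≢ P↩ f {x} {y} = mk⇔
  (λ no-codes b≡ → no-codes (index x) (index y)
    (sym (strictlyInverseˡ x) , sym (strictlyInverseˡ y) , trans b≡ (sym (cong₂ f (strictlyInverseˡ x) (strictlyInverseˡ y)))))
  (λ b≢ i i′ (x≡ , y≡ , b≡) → b≢ (trans b≡ (sym (cong₂ f x≡ y≡))))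
  where open LeftInverse P↩ using (strictlyInverseˡ) renaming (from to index)

xorSum-false : ∀ r → xorSum r (λ _ → false) ≡ false
xorSum-false zero    = refl
xorSum-false (suc r) = xorSum-false r

xorSum-select : ∀ {r} (i : Fin r) (f : Fin r → Bool) → xorSum r (λ j → does (i ≟ j) ∧ f j) ≡ f i
xorSum-select {suc r} Fin.zero    f = trans (cong (f Fin.zero xor_) (xorSum-false r)) (xor-identityʳ _)
xorSum-select {suc r} (Fin.suc i) f = xorSum-select i (f ∘ Fin.suc)

-- Row x of the cut matrix is the row of the code of its label, so the r code rows span the row space.
labelledCut⇒CutRankAtMost : ∀ {c} (G : Graph c) (X : V G → Bool) {P : Set} {r} → Fin r ↩ P →
  (label : V G → P) (f : P → P → Bool) →
  (∀ x y → X x ≡ true → X y ≡ false → adj G x y ≡ f (label x) (label y)) →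
  CutRankAtMost G X r
labelledCut⇒CutRankAtMost G X {r = r} P↩ label f adj≡f =
  (λ i y → f (code i) (label y)) , λ x Xx → (λ i → does (index (label x) ≟ i)) , λ y Xy →
    begin
      adj G x y                                  ≡⟨ adj≡f x y Xx Xy ⟩
      f (label x) (label y)                      ≡⟨ cong (λ p → f p (label y)) (strictlyInverseˡ (label x)) ⟨
      f (code (index (label x))) (label y)       ≡⟨ xorSum-select (index (label x)) _ ⟨
      xorSum r (λ i → does (index (label x) ≟ i) ∧ f (code i) (label y)) ∎
  where
  open LeftInverse P↩ using (strictlyInverseˡ) renaming (to to code; from to index)
  open ≡-Reasoning

Unique⇒lookup-injective : ∀ {A : Set} {xs : List A} → Unique xs →
                          ∀ {i j} → lookupₗ xs i ≡ lookupₗ xs j → i ≡ j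
Unique⇒lookup-injective (_ ∷ᵖ _)     {Fin.zero}  {Fin.zero}  _  = refl
Unique⇒lookup-injective (x∉xs ∷ᵖ _)  {Fin.zero}  {Fin.suc j} eq = ⊥-elim (All.lookup x∉xs (∈-lookup j) eq)
Unique⇒lookup-injective (x∉xs ∷ᵖ _)  {Fin.suc i} {Fin.zero}  eq = ⊥-elim (All.lookup x∉xs (∈-lookup i) (sym eq))
Unique⇒lookup-injective (_ ∷ᵖ uniq) {Fin.suc i} {Fin.suc j} eq = cong Fin.suc (Unique⇒lookup-injective uniq eq)

Unique⇒length≤ : ∀ {n} {xs : List (Fin n)} → Unique xs → length xs ≤ n
Unique⇒length≤ uniq = injective⇒≤ (Unique⇒lookup-injective uniq)

module _ {n : ℕ} {R : Fin n → Fin n → Set} where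

  All-verts-source : ∀ {P : Fin n → Set} {s t} (w : Walk R s t) → All P (verts w) → P s
  All-verts-source (stop _)   (p ∷ᵃ _) = p
  All-verts-source (step _ _) (p ∷ᵃ _) = p

  walk-snoc : ∀ {s t u} → Walk R s t → R t u → Walk R s u
  walk-snoc (stop _)    r = step r (stop _)
  walk-snoc (step r′ w) r = step r′ (walk-snoc w r)

  suffixFrom : ∀ {s t x} (w : Walk R s t) → x ∈ verts w →
               Σ (Walk R x t) λ w′ → Unique (verts w) → Unique (verts w′)
  suffixFrom (stop v)   (here refl)  = stop v , id
  suffixFrom (step r w) (here refl)  = step r w , id
  suffixFrom (step r w) (there x∈w) =
    let (w′ , unique) = suffixFrom w x∈w in w′ , λ { (_ ∷ᵖ uniq) → unique uniq }

  -- Loop erasure: if the first vertex recurs in the erased rest, restart from that occurrence.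
  walk⇒path : ∀ {s t} → Walk R s t → Path R s t
  walk⇒path (stop v) = stop v , (All.[] ∷ᵖ []ᵖ)
  walk⇒path (step {u} r w) with walk⇒path w
  ... | p , uniq with Any.any? (u ≟_) (verts p)
  ... | yes u∈p = let (p′ , unique) = suffixFrom p u∈p in p′ , unique uniq
  ... | no u∉p  = step r p , (¬Any⇒All¬ _ u∉p ∷ᵖ uniq)

  Escapes : (Fin n → Bool) → Set
  Escapes X = Σ (Fin n) λ u → Σ (Fin n) λ v → X u ≡ true × ¬ X v ≡ true × R u v

  walk-stays : ∀ {X s t} → ¬ Escapes X → X s ≡ true → Walk R s t → X t ≡ true
  walk-stays closed Xs (stop _) = Xs
  walk-stays {X} closed Xs (step {v = v} r w) with X v Bool.≟ true
  ... | yes Xv = walk-stays closed Xv w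
  ... | no ¬Xv = ⊥-elim (closed (_ , v , Xs , ¬Xv , r))

  module _ (R? : ∀ u v → Dec (R u v)) where

    boundedWalk? : ∀ b s t → Dec (Σ (Walk R s t) λ w → length (verts w) ≤ b)
    boundedWalk? zero    s t = no λ { (stop _ , ()) ; (step _ _ , ()) }
    boundedWalk? (suc b) s t with s ≟ t
    ... | yes refl = yes (stop s , s≤s z≤n)
    ... | no s≢t with any? (λ x → R? s x ×-dec boundedWalk? b x t)
    ... | yes (_ , r , w , len≤b) = yes (step r w , s≤s len≤b)
    ... | no ¬step = no λ { (stop _ , _) → s≢t refl
                          ; (step r w , s≤s len≤b) → ¬step (_ , r , w , len≤b) }

    walk? : ∀ s t → Dec (Walk R s t)
    walk? s t = map′ proj₁ (λ w → let (p , uniq) = walk⇒path w in p , Unique⇒length≤ uniq) (boundedWalk? n s t)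

    reachable : Fin n → Fin n → Bool
    reachable s v = isYes (walk? s v)

    reachable⇔walk : ∀ {s v} → (reachable s v ≡ true) ⇔ Walk R s v
    reachable⇔walk = ⇔-trans (⇔-sym T-≡) True⇔

    reachable-closed : ∀ s → ¬ Escapes (reachable s)
    reachable-closed s (_ , _ , Ru , ¬Rv , r) = ¬Rv (from reachable⇔walk (walk-snoc (to reachable⇔walk Ru) r))

    -- If t is unreachable, the set reachable from s separates it from s.
    noSeparator⇔path : (Admissible Closed : (Fin n → Bool) → Set) → (∀ X → Closed X ⇔ (¬ Escapes X)) →
      ∀ {s t} → Admissible (reachable s) →
      (¬ Σ (Fin n → Bool) λ X → Admissible X × X s ≡ true × Closed X × ¬ X t ≡ true) ⇔ Path R s t
    noSeparator⇔path Admissible Closed Closed⇔ {s} {t} admissible = mk⇔ unseparated⇒path path⇒unseparated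
      where
      Separator : Set
      Separator = Σ (Fin n → Bool) λ X → Admissible X × X s ≡ true × Closed X × ¬ X t ≡ true

      unseparated⇒path : ¬ Separator → Path R s t
      unseparated⇒path noSeparator = walk⇒path (decidable-stable (walk? s t) λ ¬walk →
        noSeparator (reachable s , admissible , from reachable⇔walk (stop s) ,
                     from (Closed⇔ _) (reachable-closed s) , ¬walk ∘ to reachable⇔walk))

      path⇒unseparated : Path R s t → ¬ Separator
      path⇒unseparated p (X , _ , Xs , closed , ¬Xt) = ¬Xt (walk-stays (to (Closed⇔ X) closed) Xs (proj₁ p))

module _ {n : ℕ} {R S : Fin n → Fin n → Set} {P : Fin n → Set}
         (S⇔R-into-P : ∀ {u v} → P u → S u v ⇔ (R u v × P v)) where

  walkWithin : ∀ {s t} (w : Walk R s t) → All P (verts w) → Σ (Walk S s t) λ w′ → verts w′ ≡ verts w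
  walkWithin (stop v)   _           = stop v , refl
  walkWithin (step r w) (Ps ∷ᵃ Pw) =
    let (w′ , same) = walkWithin w Pw in
    step (from (S⇔R-into-P Ps) (r , All-verts-source w Pw)) w′ , cong (_ ∷ₗ_) same

  walkFrom : ∀ {s t} → P s → (w : Walk S s t) → Σ (Walk R s t) λ w′ → verts w′ ≡ verts w × All P (verts w′)
  walkFrom Ps (stop v)   = stop v , refl , (Ps ∷ᵃ All.[])
  walkFrom Ps (step r w) =
    let (r′ , Pv) = to (S⇔R-into-P Ps) r ; (w′ , same , Pw′) = walkFrom Pv w in
    step r′ w′ , cong (_ ∷ₗ_) same , (Ps ∷ᵃ Pw′)

  path-restriction : ∀ {s t} → (Path S s t × P s) ⇔ Σ (Path R s t) λ p → All P (verts (proj₁ p))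
  path-restriction = mk⇔
    (λ ((w , uniq) , Ps) → let (w′ , same , Pw′) = walkFrom Ps w in (w′ , subst Unique (sym same) uniq) , Pw′)
    (λ ((w , uniq) , Pw) → let (w′ , same) = walkWithin w Pw in (w′ , subst Unique (sym same) uniq) , All-verts-source w Pw)

module _ {c : ℕ} {Atom : ℕ → Set} {Q : Set} {k m : ℕ} where

  allᶠ : ∀ {n} → Fin k → (Fin n → Formula c Atom Q k m) → Formula c Atom Q k m
  allᶠ {zero}  x φs = eqᶠ x x
  allᶠ {suc n} x φs = andᶠ (φs Fin.zero) (allᶠ x (φs ∘ Fin.suc))

  litᶠ : Bool → Formula c Atom Q k m → Formula c Atom Q k m
  litᶠ true  φ = φ
  litᶠ false φ = notᶠ φ

  matrixᶠ : ∀ {a b} → Fin k → Vec (Vec Bool b) a → (Fin a → Fin b → Formula c Atom Q k m) → Formula c Atom Q k m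
  matrixᶠ x M φ = allᶠ x λ i → allᶠ x λ j → litᶠ (entry M i j) (φ i j)

  atpᶠ : ∀ {j} → Atp c (suc j) → (Fin (suc j) → Fin k) → Formula c Atom Q k m
  atpᶠ (mkAtp E D C) W =
    andᶠ (matrixᶠ x E λ i i′ → eqᶠ (W i) (W i′))
         (andᶠ (matrixᶠ x D λ i i′ → edgeᶠ (W i) (W i′))
               (matrixᶠ x C λ u i → colᶠ u (W i)))
    where
    x : Fin k
    x = W Fin.zero

module FormulaSemantics {c : ℕ} {Atom : ℕ → Set} {Q : Set}
  (semAtom : ∀ {k} → Atom k → (G : Graph c) → (Fin k → V G) → Set)
  (semQ : Q → (G : Graph c) → (V G → Bool) → Set)
  {k m : ℕ} (G : Graph c) (ρ : Fin k → V G) (σ : Fin m → V G → Bool) where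

  ⟦_⟧ : Formula c Atom Q k m → Set
  ⟦ φ ⟧ = sem semAtom semQ φ G ρ σ

  allᶠ-sem : ∀ {n} x (φs : Fin n → Formula c Atom Q k m) → ⟦ allᶠ x φs ⟧ ⇔ (∀ i → ⟦ φs i ⟧)
  allᶠ-sem {zero}  x φs = mk⇔ (λ _ ()) (λ _ → refl)
  allᶠ-sem {suc n} x φs = mk⇔
    (λ { (p , ps) Fin.zero → p ; (p , ps) (Fin.suc i) → to (allᶠ-sem x (φs ∘ Fin.suc)) ps i })
    (λ ps → ps Fin.zero , from (allᶠ-sem x (φs ∘ Fin.suc)) (ps ∘ Fin.suc))

  litᶠ-sem : ∀ {φ b} b′ → ⟦ φ ⟧ ⇔ T b → ⟦ litᶠ b′ φ ⟧ ⇔ (b ≡ b′)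
  litᶠ-sem true  φ⇔b = ⇔-trans φ⇔b T-≡
  litᶠ-sem false φ⇔b = ⇔-trans (¬-cong-⇔ φ⇔b) ¬T⇔≡false

  matrixᶠ-sem : ∀ {a b} x M (φ : Fin a → Fin b → Formula c Atom Q k m) (f : Fin a → Fin b → Bool) →
                (∀ i j → ⟦ φ i j ⟧ ⇔ T (f i j)) → ⟦ matrixᶠ x M φ ⟧ ⇔ (tabulate² f ≡ M)
  matrixᶠ-sem x M φ f φ⇔f =
    ⇔-trans (allᶠ-sem x _)
   (⇔-trans (∀-cong-⇔ λ i → ⇔-trans (allᶠ-sem x _) (∀-cong-⇔ λ j → litᶠ-sem (entry M i j) (φ⇔f i j)))
            (tabulate²-≡⇔ f M))

  atpᶠ-sem : ∀ {j} (p : Atp c (suc j)) W {w : Fin (suc j) → V G} → (∀ i → ρ (W i) ≡ w i) →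
             ⟦ atpᶠ p W ⟧ ⇔ (atp G w ≡ p)
  atpᶠ-sem (mkAtp E D C) W {w} W≗w =
    ⇔-trans (matrixᶠ-sem x E (λ i i′ → eqᶠ (W i) (W i′)) _ eq⇔
         ×-⇔ (matrixᶠ-sem x D (λ i i′ → edgeᶠ (W i) (W i′)) _ edge⇔
         ×-⇔  matrixᶠ-sem x C (λ u i → colᶠ u (W i)) _ col⇔))
      mkAtp-≡⇔
    where
    x : Fin k
    x = W Fin.zero
    eq⇔ : ∀ i i′ → (ρ (W i) ≡ ρ (W i′)) ⇔ T (isYes (w i ≟ w i′))
    eq⇔ i i′ = ⇔-trans (mk⇔ (λ e → trans (sym (W≗w i)) (trans e (W≗w i′)))
                            (λ e → trans (W≗w i) (trans e (sym (W≗w i′)))))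
                       (⇔-sym True⇔)
    edge⇔ : ∀ i i′ → Edge G (ρ (W i)) (ρ (W i′)) ⇔ T (adj G (w i) (w i′))
    edge⇔ i i′ rewrite W≗w i | W≗w i′ = ⇔-refl
    col⇔ : ∀ u i → T (col G u (ρ (W i))) ⇔ T (col G u (w i))
    col⇔ u i rewrite W≗w i = ⇔-refl
    mkAtp-≡⇔ : ∀ {E′ D′ C′} → (E′ ≡ E × D′ ≡ D × C′ ≡ C) ⇔ (mkAtp E′ D′ C′ ≡ mkAtp E D C)
    mkAtp-≡⇔ = mk⇔ (λ { (refl , refl , refl) → refl }) (λ { refl → refl , refl , refl })

module Translation {c : ℕ} {Atom₁ Atom₂ : ℕ → Set} {Q : Set}
  (sem₁ : ∀ {k} → Atom₁ k → (G : Graph c) → (Fin k → V G) → Set)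
  (sem₂ : ∀ {k} → Atom₂ k → (G : Graph c) → (Fin k → V G) → Set)
  (semQ : Q → (G : Graph c) → (V G → Bool) → Set)
  (τ : ∀ {k m} → Atom₁ k → Formula c Atom₂ Q k m)
  (τ-sem : ∀ {k m} (a : Atom₁ k) G ρ (σ : Fin m → V G → Bool) → sem₁ a G ρ ⇔ sem sem₂ semQ (τ a) G ρ σ)
  where

  translate : ∀ {k m} → Formula c Atom₁ ⊥ k m → Formula c Atom₂ Q k m
  translate (eqᶠ x y)   = eqᶠ x y
  translate (edgeᶠ x y) = edgeᶠ x y
  translate (colᶠ u x)  = colᶠ u x
  translate (memᶠ x X)  = memᶠ x X
  translate (atomᶠ a)   = τ a
  translate (notᶠ φ)    = notᶠ (translate φ)
  translate (andᶠ φ ψ)  = andᶠ (translate φ) (translate ψ)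
  translate (exVᶠ φ)    = exVᶠ (translate φ)
  translate (exSᶠ () φ)

  translate-sem : ∀ {k m} (φ : Formula c Atom₁ ⊥ k m) → Equiv (sem sem₁ noSetQ φ) (sem sem₂ semQ (translate φ))
  translate-sem (eqᶠ x y)   G ρ σ = ⇔-refl
  translate-sem (edgeᶠ x y) G ρ σ = ⇔-refl
  translate-sem (colᶠ u x)  G ρ σ = ⇔-refl
  translate-sem (memᶠ x X)  G ρ σ = ⇔-refl
  translate-sem (atomᶠ a)   G ρ σ = τ-sem a G ρ σ
  translate-sem (notᶠ φ)    G ρ σ = ¬-cong-⇔ (translate-sem φ G ρ σ)
  translate-sem (andᶠ φ ψ)  G ρ σ = translate-sem φ G ρ σ ×-⇔ translate-sem ψ G ρ σ
  translate-sem (exVᶠ φ)    G ρ σ = ∃-cong-⇔ λ v → translate-sem φ G (v ∷ᶠ ρ) σ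
  translate-sem (exSᶠ () φ)

  expressible : ∀ {k m} (φ : Formula c Atom₁ ⊥ k m) →
                Σ (Formula c Atom₂ Q k m) λ ψ → Equiv (sem sem₁ noSetQ φ) (sem sem₂ semQ ψ)
  expressible φ = translate φ , translate-sem φ

-- Separator logic into flip-connectivity logic

module _ {c j : ℕ} where

  -- The head of p is a tuple vertex xᵢ and the head of q is adjacent to xᵢ.
  tupleEdge : Atp c (suc j) → Atp c (suc j) → Bool
  tupleEdge p q = isYes (any? λ i → T? (entry (Atp.eqs p) Fin.zero (Fin.suc i) ∧ entry (Atp.edgs q) Fin.zero (Fin.suc i)))

  deleteTupleEdges : Atp c (suc j) → Atp c (suc j) → Bool
  deleteTupleEdges p q = tupleEdge p q ∨ tupleEdge q p

  deleteTupleEdges-sym : ∀ p q → deleteTupleEdges p q ≡ deleteTupleEdges q p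
  deleteTupleEdges-sym p q = ∨-comm (tupleEdge p q) (tupleEdge q p)

module _ {c : ℕ} (G : Graph c) where

  Edge⇒≢ : ∀ {u v} → Edge G u v → u ≢ v
  Edge⇒≢ {u} e refl = subst T (irrefl G u) e

  module _ {j} (a : Fin j → V G) where

    Avoids : V G → Set
    Avoids v = ∀ i → v ≢ a i

    tupleEdge-atp : ∀ {u v} → T (tupleEdge (atp G (u ∷ᶠ a)) (atp G (v ∷ᶠ a))) ⇔ (∃ λ i → u ≡ a i × Edge G v (a i))
    tupleEdge-atp {u} {v} = ⇔-trans True⇔ (∃-cong-⇔ λ i → ⇔-trans T-∧ (eq-bit i ×-⇔ edge-bit i))
      where
      eq-bit : ∀ i → T (entry (Atp.eqs (atp G (u ∷ᶠ a))) Fin.zero (Fin.suc i)) ⇔ (u ≡ a i)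
      eq-bit i = subst (λ b → T b ⇔ _)
        (sym (entry-tabulate² (λ i′ i″ → isYes ((u ∷ᶠ a) i′ ≟ (u ∷ᶠ a) i″)) Fin.zero (Fin.suc i))) True⇔
      edge-bit : ∀ i → T (entry (Atp.edgs (atp G (v ∷ᶠ a))) Fin.zero (Fin.suc i)) ⇔ Edge G v (a i)
      edge-bit i = subst (λ b → T b ⇔ _)
        (sym (entry-tabulate² (λ i′ i″ → adj G ((v ∷ᶠ a) i′) ((v ∷ᶠ a) i″)) Fin.zero (Fin.suc i))) ⇔-refl

    deleteTupleEdges-arc : ∀ {u v} → Avoids u → FlipArc G deleteTupleEdges a u v ⇔ (Edge G u v × Avoids v)
    deleteTupleEdges-arc {u} {v} u∉a = mk⇔
      (λ (_ , t) → to xor⇔ (subst (T ∘ (adj G u v xor_)) flip≡ t))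
      (λ (e , v∉a) → Edge⇒≢ e , subst (T ∘ (adj G u v xor_)) (sym flip≡) (from xor⇔ (e , v∉a)))
      where
      tu tv : Atp c (suc j)
      tu = atp G (u ∷ᶠ a)
      tv = atp G (v ∷ᶠ a)

      flip≡ : deleteTupleEdges tu tv ≡ tupleEdge tv tu
      flip≡ = cong (_∨ tupleEdge tv tu) (to ¬T⇔≡false λ t → let (i , u≡aᵢ , _) = to tupleEdge-atp t in u∉a i u≡aᵢ)

      xor⇔ : T (adj G u v xor tupleEdge tv tu) ⇔ (T (adj G u v) × Avoids v)
      xor⇔ with adj G u v in uv | tupleEdge tv tu in vu
      ... | true | true =
        let (i , v≡aᵢ , _) = to tupleEdge-atp (subst T (sym vu) _) in mk⇔ (λ ()) (λ (_ , v∉a) → v∉a i v≡aᵢ)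
      ... | true | false = mk⇔ (λ _ → _ , v∉a) (λ _ → _)
        where
        v∉a : Avoids v
        v∉a i v≡aᵢ = subst T vu (from tupleEdge-atp (i , v≡aᵢ , subst (Edge G u) v≡aᵢ (subst T (sym uv) _)))
      ... | false | true =
        let (i , v≡aᵢ , e) = to tupleEdge-atp (subst T (sym vu) _) in
        ⊥-elim (subst T uv (subst (Edge G u) (sym v≡aᵢ) e))
      ... | false | false = mk⇔ (λ ()) (λ ())

connᶠ : ∀ {c k m} → SepAtom k → FlipConnFormula c k m
connᶠ (conn j s t as) =
  andᶠ (atomᶠ (flipconn j deleteTupleEdges deleteTupleEdges-sym s t as)) (allᶠ s λ i → notᶠ (eqᶠ s (as i)))

connᶠ-sem : ∀ {c k m} (a : SepAtom k) (G : Graph c) ρ (σ : Fin m → V G → Bool) →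
            semSep a G ρ ⇔ ⟦ connᶠ a ⟧FC G ρ σ
connᶠ-sem (conn j s t as) G ρ σ =
  ⇔-sym (⇔-trans (⇔-refl ×-⇔ allᶠ-sem s _) (path-restriction (deleteTupleEdges-arc G (ρ ∘ as))))
  where open FormulaSemantics semFlipConn noSetQ G ρ σ

flipconnᶠ : ∀ {c k m} → FlipConnAtom c k → FlipReachFormula c k m
flipconnᶠ (flipconn j A _ s t as) = atomᶠ (flipreach j A s t as)

-- Flip-reachability logic into low rank MSO

module _ {c : ℕ} (G : Graph c) {j} (A : Atp c (suc j) → Atp c (suc j) → Bool) (a : Fin j → V G) where

  flipArc? : ∀ u v → Dec (FlipArc G A a u v)
  flipArc? u v = ¬? (u ≟ v) ×-dec T? _

  -- Across a cut closed under arcs the flip changes no adjacency, so adjacency is read off the atomic types.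
  closed⇒CutRankAtMost : ∀ {X} → ¬ Escapes {R = FlipArc G A a} X → CutRankAtMost G X (atpCodes c (suc j))
  closed⇒CutRankAtMost {X} closed =
    labelledCut⇒CutRankAtMost G X (Atp-↩ c (suc j)) (λ v → atp G (v ∷ᶠ a)) A adj≡A
    where
    adj≡A : ∀ x y → X x ≡ true → X y ≡ false → adj G x y ≡ A (atp G (x ∷ᶠ a)) (atp G (y ∷ᶠ a))
    adj≡A x y Xx Xy with adj G x y Bool.≟ A (atp G (x ∷ᶠ a)) (atp G (y ∷ᶠ a))
    ... | yes adj≡ = adj≡
    ... | no adj≢ = ⊥-elim (closed (x , y , Xx , not-¬ Xy , x≢y , from T-xor⇔≢ adj≢))
      where
      x≢y : x ≢ y
      x≢y refl = not-¬ Xy Xx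

module _ {c k j : ℕ} (A : Atp c (suc j) → Atp c (suc j) → Bool) (as : Fin j → Fin k) where

  private
    code : Fin (atpCodes c (suc j)) → Atp c (suc j)
    code = LeftInverse.to (Atp-↩ c (suc j))

    head tail : Fin (suc (suc k))
    head = Fin.zero
    tail = Fin.suc Fin.zero

    tuple : Fin (suc (suc k)) → Fin (suc j) → Fin (suc (suc k))
    tuple x = x ∷ᶠ (Fin.suc ∘ Fin.suc ∘ as)

  -- The xor with A is expressed without disjunction: no pair of codes describing the atomic types of the
  -- endpoints may leave their adjacency equal to A of the codes.
  arcᶠ : ∀ {m} → LowRankMSO c (suc (suc k)) m
  arcᶠ = andᶠ (notᶠ (eqᶠ tail head)) (allᶠ head λ i → allᶠ head λ i′ →
           notᶠ (andᶠ (atpᶠ (code i) (tuple tail))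
                (andᶠ (atpᶠ (code i′) (tuple head))
                      (litᶠ (A (code i) (code i′)) (edgeᶠ tail head)))))

  arcᶠ-sem : ∀ {m} (G : Graph c) ρ (σ : Fin m → V G → Bool) u v →
             ⟦ arcᶠ ⟧LR G (v ∷ᶠ (u ∷ᶠ ρ)) σ ⇔ FlipArc G A (ρ ∘ as) u v
  arcᶠ-sem G ρ σ u v =
    ⇔-refl ×-⇔
      ⇔-trans (allᶠ-sem head _)
     (⇔-trans (∀-cong-⇔ λ i → ⇔-trans (allᶠ-sem head _) (∀-cong-⇔ λ i′ →
                 ¬-cong-⇔ (atpᶠ-sem (code i) (tuple tail) names-tail
                       ×-⇔ (atpᶠ-sem (code i′) (tuple head) names-head
                       ×-⇔ litᶠ-sem (A (code i) (code i′)) ⇔-refl))))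
     (⇔-trans (codes-≢⇔≢ (Atp-↩ c (suc j)) A) (⇔-sym T-xor⇔≢)))
    where
    open FormulaSemantics noAtom (λ r G X → CutRankAtMost G X r) G (v ∷ᶠ (u ∷ᶠ ρ)) σ
    names-tail : ∀ i → (v ∷ᶠ (u ∷ᶠ ρ)) (tuple tail i) ≡ (u ∷ᶠ (ρ ∘ as)) i
    names-tail Fin.zero    = refl
    names-tail (Fin.suc i) = refl
    names-head : ∀ i → (v ∷ᶠ (u ∷ᶠ ρ)) (tuple head i) ≡ (v ∷ᶠ (ρ ∘ as)) i
    names-head Fin.zero    = refl
    names-head (Fin.suc i) = refl

  closedᶠ : ∀ {m} → LowRankMSO c k (suc m)
  closedᶠ = notᶠ (exVᶠ (exVᶠ (andᶠ (memᶠ tail Fin.zero) (andᶠ (notᶠ (memᶠ head Fin.zero)) arcᶠ))))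

  closedᶠ-sem : ∀ {m} (G : Graph c) ρ (σ : Fin m → V G → Bool) X →
                ⟦ closedᶠ ⟧LR G ρ (X ∷ᶠ σ) ⇔ (¬ Escapes {R = FlipArc G A (ρ ∘ as)} X)
  closedᶠ-sem G ρ σ X =
    ¬-cong-⇔ (∃-cong-⇔ λ u → ∃-cong-⇔ λ v → ⇔-refl ×-⇔ (⇔-refl ×-⇔ arcᶠ-sem G ρ (X ∷ᶠ σ) u v))

  reachᶠ : ∀ {m} → Fin k → Fin k → LowRankMSO c k m
  reachᶠ s t = notᶠ (exSᶠ (atpCodes c (suc j)) (andᶠ (memᶠ s Fin.zero) (andᶠ closedᶠ (notᶠ (memᶠ t Fin.zero)))))

  reachᶠ-sem : ∀ {m} s t (G : Graph c) ρ (σ : Fin m → V G → Bool) →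
               ⟦ reachᶠ s t ⟧LR G ρ σ ⇔ Path (FlipArc G A (ρ ∘ as)) (ρ s) (ρ t)
  reachᶠ-sem s t G ρ σ =
    noSeparator⇔path (flipArc? G A (ρ ∘ as)) (λ X → CutRankAtMost G X (atpCodes c (suc j)))
      (λ X → ⟦ closedᶠ ⟧LR G ρ (X ∷ᶠ σ)) (closedᶠ-sem G ρ σ)
      (closed⇒CutRankAtMost G A (ρ ∘ as) (reachable-closed (flipArc? G A (ρ ∘ as)) (ρ s)))

flipreachᶠ : ∀ {c k m} → FlipReachAtom c k → LowRankMSO c k m
flipreachᶠ (flipreach j A s t as) = reachᶠ A as s t

flipreachᶠ-sem : ∀ {c k m} (a : FlipReachAtom c k) (G : Graph c) ρ (σ : Fin m → V G → Bool) →
                 semFlipReach a G ρ ⇔ ⟦ flipreachᶠ a ⟧LR G ρ σ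
flipreachᶠ-sem (flipreach j A s t as) G ρ σ = ⇔-sym (reachᶠ-sem A as s t G ρ σ)

proposition2p6 :
    ((c k m : ℕ) (φ : SepFormula c k m) →
       Σ (FlipConnFormula c k m) λ ψ → Equiv ⟦ φ ⟧Sep ⟦ ψ ⟧FC)
    × ((c k m : ℕ) (φ : FlipConnFormula c k m) →
       Σ (FlipReachFormula c k m) λ ψ → Equiv ⟦ φ ⟧FC ⟦ ψ ⟧FR)
    × ((c k m : ℕ) (φ : FlipReachFormula c k m) →
       Σ (LowRankMSO c k m) λ ψ → Equiv ⟦ φ ⟧FR ⟦ ψ ⟧LR)
proposition2p6 =
    (λ c k m → Translation.expressible semSep semFlipConn noSetQ connᶠ connᶠ-sem)
  , (λ c k m → Translation.expressible semFlipConn semFlipReach noSetQ flipconnᶠ (λ _ _ _ _ → ⇔-refl))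
  , (λ c k m → Translation.expressible semFlipReach noAtom (λ r G X → CutRankAtMost G X r) flipreachᶠ flipreachᶠ-sem)
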